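{- Let $r\ge 4$, let $n$ be sufficiently large, and let $A$ be an independent set in $G(n,r,1)$, with $A_0=\{v_1,\dots,v_k\}$, $I_0$, $A_1$, $P$ and the notion "connected" as defined in the context. Then no element $x\in[n]\setminus(I_0\cup P)$ is connected to two different vertices $v_i\neq v_j$ of $A_0$.
   Context: $G(n,r,1)$ is the graph whose vertex set is the family of all $r$-element subsets of $[n]=\{1,\dots,n\}$, two vertices being adjacent iff they intersect in exactly one element (so members of an independent set pairwise meet in $0$ or at least $2$ elements). Given an independent set $A$, let $A_0=\{v_1,\dots,v_k\}\subseteq A$ be a subfamily of maximum size among subfamilies of $A$ consisting of pairwise disjoint sets, and $I_0=v_1\cup\dots\cup v_k$. For $i\ge1$, $A_i$ is the set of $v\in A\setminus A_0$ that intersect exactly $i$ of the sets $v_1,\dots,v_k$. Let $\omega=\omega(r,n)=1$ if $r=4$ and $\omega=r^5\binom{n}{r-5}$ if $r\ge5$. An element $x\in[n]\setminus I_0$ is connected to $v_i$ if at least $\omega$ members of $A_1$ contain $x$ and intersect $v_i$. Two distinct elements $x,y$ are joint if $|v\cap\{x,y\}|\neq 1$ for every $v\in A_1$. $P$ is the set of elements of $[n]\setminus I_0$ that are joint with some other element of $[n]\setminus I_0$. -}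

module Defs where

open import Data.Nat using (ℕ; zero; suc; _+_; _*_; _∸_; _^_; _≤_; _<_)
open import Data.Nat.Combinatorics using (_C_)
open import Data.Bool using (Bool)
import Data.Bool as B
open import Data.Fin using (Fin)
open import Data.Fin.Subset using (Subset; _∈_; _∉_; _∩_; _∪_; ∣_∣; ⁅_⁆; ⊥)
open import Data.Fin.Subset.Properties using (_∈?_)
open import Data.Vec.Properties using (≡-dec)
open import Data.List using (List; length; filter; lookup; foldr)
open import Data.List.Membership.Propositional using () renaming (_∈_ to _∈ₗ_; _∉_ to _∉ₗ_)
open import Data.List.Membership.DecPropositional using () 
open import Data.List.Relation.Unary.Unique.Propositional using (Unique)
open import Data.Product using (_×_; ∃; Σ)
open import Relation.Nullary using (¬_; Dec)
open import Relation.Nullary.Decidable.Core using (_×-dec_)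
open import Relation.Binary.PropositionalEquality using (_≡_; _≢_)
import Data.Nat as N

_≟ₛ_ : ∀ {n} (u v : Subset n) → Dec (u ≡ v)
_≟ₛ_ = ≡-dec B._≟_

-- a family of subsets of [n] is represented as a duplicate-free list
-- (Unique is imposed where needed)

-- A is an independent set of G(n,r,1): a set of r-subsets of [n],
-- any two distinct members of which do not meet in exactly one element.
Independent : ∀ {n} → ℕ → List (Subset n) → Set
Independent {n} r A =
  Unique A ×
  (∀ v → v ∈ₗ A → ∣ v ∣ ≡ r) ×
  (∀ u v → u ∈ₗ A → v ∈ₗ A → u ≢ v → ¬ (∣ u ∩ v ∣ ≡ 1))

DisjointSubfamily : ∀ {n} → List (Subset n) → List (Subset n) → Set
DisjointSubfamily A B =
  Unique B ×
  (∀ v → v ∈ₗ B → v ∈ₗ A) ×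
  (∀ u v → u ∈ₗ B → v ∈ₗ B → u ≢ v → ∣ u ∩ v ∣ ≡ 0)

MaxDisjointSubfamily : ∀ {n} → List (Subset n) → List (Subset n) → Set
MaxDisjointSubfamily A A₀ =
  DisjointSubfamily A A₀ ×
  (∀ B → DisjointSubfamily A B → length B ≤ length A₀)

unionAll : ∀ {n} → List (Subset n) → Subset n
unionAll = foldr _∪_ ⊥

meetCount : ∀ {n} → List (Subset n) → Subset n → ℕ
meetCount A₀ v = length (filter (λ u → 1 N.≤? ∣ v ∩ u ∣) A₀)

A₁ : ∀ {n} → List (Subset n) → List (Subset n) → List (Subset n)
A₁ {n} A A₀ = filter (λ v → (v ∉? A₀) ×-dec (meetCount A₀ v N.≟ 1)) A
  where
    open import Data.List.Membership.DecPropositional (_≟ₛ_ {n}) using (_∉?_)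

ω : ℕ → ℕ → ℕ
ω 4 n = 1
ω r n = r ^ 5 * (n C (r ∸ 5))

Connected : ∀ {n} → ℕ → List (Subset n) → (A₀ : List (Subset n)) →
            Fin n → Fin (length A₀) → Set
Connected {n} r A A₀ x i =
  ω r n ≤ length (filter (λ v → (x ∈? v) ×-dec (1 N.≤? ∣ v ∩ lookup A₀ i ∣)) (A₁ A A₀))

Joint : ∀ {n} → List (Subset n) → List (Subset n) → Fin n → Fin n → Set
Joint A A₀ x y =
  x ≢ y × (∀ v → v ∈ₗ A₁ A A₀ → ¬ (∣ v ∩ (⁅ x ⁆ ∪ ⁅ y ⁆) ∣ ≡ 1))

InP : ∀ {n} → List (Subset n) → List (Subset n) → Fin n → Set
InP A A₀ x =
  x ∉ unionAll A₀ × ∃ (λ y → y ∉ unionAll A₀ × Joint A A₀ x y)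

-- Let U (resp. W) be the members of A₁ that contain x and meet
-- vᵢ (resp. vⱼ); connectedness says |U|, |W| ≥ ω.  A member of A₁ meets only
-- one block, so u ∈ U and w ∈ W are different; both contain x, hence (by
-- independence) they share a second point y, and y ∉ I₀ since otherwise u and
-- w would meet a common block.  As x ∉ P, some s ∈ A₁ separates x from y, and
-- s misses vⱼ or vᵢ.  So every pair (u , w) is "linked": w contains a point y
-- of u separated from x by a member of A₁ missing vⱼ, or symmetrically with
-- the roles of (u , i) and (w , j) exchanged.  A set w linked to a fixed u
-- contains five distinct points x, y, t, a, b with y ∈ u, t ∈ s, a, b ∈ vⱼ;
-- there are at most r⁴ such choices and at most C(n, r-5) r-sets through five
-- given points (none if r = 4), so each u is linked to at most
-- D = r⁴·C(n, r-5) sets (D = 0 for r = 4), and likewise each w.  Double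
-- counting gives |U|·|W| ≤ (|U| + |W|)·D, contradicting |U|, |W| ≥ ω > 2D.
module Submission where

open import Defs
open import Data.Nat using (ℕ; zero; suc; _+_; _*_; _≤_; _<_; z≤n; s≤s; >-nonZero)
import Data.Nat as N
open import Data.Nat.Properties
open import Data.Nat.Combinatorics using (_C_; nCk+nC[k+1]≡[n+1]C[k+1])
open import Data.Nat.Tactic.RingSolver using (solve-∀)
open import Data.Bool using (true; false)
open import Data.Fin using (Fin; zero; suc)
import Data.Fin.Properties as Fin
open import Data.Fin.Subset using (Subset; _∈_; _∉_; _∩_; _∪_; ∣_∣; ⁅_⁆; _-_; _⊆_; Nonempty) renaming (⊥ to ∅)
open import Data.Fin.Subset.Properties
open import Data.Vec using ([]; _∷_; here; there)
open import Data.List using (List; []; _∷_; length; filter; lookup; map; allFin; cartesianProduct)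
open import Data.List.Properties using (length-++; length-map; filter-some)
open import Data.List.Membership.Propositional using (find; lose) renaming (_∈_ to _∈ₗ_; _∉_ to _∉ₗ_)
open import Data.List.Membership.Propositional.Properties using (∈-filter⁺; ∈-filter⁻; ∈-lookup; ∈-allFin; ∈-cartesianProduct⁺; ∈-map⁻)
open import Data.List.Relation.Unary.Any using (Any; here; there; any?)
open import Data.List.Relation.Unary.All as All using (All; []; _∷_; all?)
open import Data.List.Relation.Unary.AllPairs using ([]; _∷_; allPairs?)
open import Data.List.Relation.Unary.Unique.Propositional using (Unique)
import Data.List.Relation.Unary.Unique.Propositional.Properties as Unique
open import Data.Product using (∃; ∃₂; _×_; _,_; proj₁; proj₂)
open import Data.Sum using (_⊎_; inj₁; inj₂)
open import Data.Empty using (⊥-elim)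
open import Function using (_∘_)
open import Relation.Nullary using (¬_; Dec; yes; no; ¬?)
open import Relation.Nullary.Decidable.Core using (_×-dec_)
open import Relation.Unary using (Decidable)
open import Relation.Binary.PropositionalEquality

sumOver : ∀ {a} {A : Set a} → (A → ℕ) → List A → ℕ
sumOver f []       = 0
sumOver f (x ∷ xs) = f x + sumOver f xs

indicator : ∀ {p} {P : Set p} → Dec P → ℕ
indicator (yes _) = 1
indicator (no _)  = 0

module _ {a} {A : Set a} where

  sumOver-cong : ∀ {f g : A → ℕ} xs → (∀ x → f x ≡ g x) → sumOver f xs ≡ sumOver g xs
  sumOver-cong []       f≡g = refl
  sumOver-cong (x ∷ xs) f≡g = cong₂ _+_ (f≡g x) (sumOver-cong xs f≡g)

  sumOver-+ : ∀ (f g : A → ℕ) xs → sumOver (λ x → f x + g x) xs ≡ sumOver f xs + sumOver g xs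
  sumOver-+ f g []       = refl
  sumOver-+ f g (x ∷ xs) = begin
    f x + g x + sumOver (λ x → f x + g x) xs    ≡⟨ cong (f x + g x +_) (sumOver-+ f g xs) ⟩
    f x + g x + (sumOver f xs + sumOver g xs)   ≡⟨ +-assoc (f x) (g x) _ ⟩
    f x + (g x + (sumOver f xs + sumOver g xs)) ≡⟨ cong (f x +_) (x+[y+z]≡y+[x+z] (g x) (sumOver f xs) _) ⟩
    f x + (sumOver f xs + (g x + sumOver g xs)) ≡⟨ +-assoc (f x) (sumOver f xs) _ ⟨
    f x + sumOver f xs + (g x + sumOver g xs)   ∎
    where
    open ≡-Reasoning
    x+[y+z]≡y+[x+z] : ∀ p q s → p + (q + s) ≡ q + (p + s)
    x+[y+z]≡y+[x+z] = solve-∀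

  sumOver-const : ∀ c (xs : List A) → sumOver (λ _ → c) xs ≡ length xs * c
  sumOver-const c []       = refl
  sumOver-const c (x ∷ xs) = cong (c +_) (sumOver-const c xs)

  sumOver-mono : ∀ {f g : A → ℕ} xs → (∀ x → x ∈ₗ xs → f x ≤ g x) → sumOver f xs ≤ sumOver g xs
  sumOver-mono []       f≤g = z≤n
  sumOver-mono (x ∷ xs) f≤g = +-mono-≤ (f≤g x (here refl)) (sumOver-mono xs (λ y y∈ → f≤g y (there y∈)))

  sumOver-bounded : ∀ {f : A → ℕ} {c} xs → (∀ x → x ∈ₗ xs → f x ≤ c) → sumOver f xs ≤ length xs * c
  sumOver-bounded {c = c} xs f≤c = ≤-trans (sumOver-mono xs f≤c) (≤-reflexive (sumOver-const c xs))

  module _ {p} {P : A → Set p} (P? : Decidable P) where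

    length-filter-∷ : ∀ x xs → length (filter P? (x ∷ xs)) ≡ indicator (P? x) + length (filter P? xs)
    length-filter-∷ x xs with P? x
    ... | yes _ = refl
    ... | no _  = refl

    count-as-sum : ∀ xs → length (filter P? xs) ≡ sumOver (λ x → indicator (P? x)) xs
    count-as-sum []       = refl
    count-as-sum (x ∷ xs) = trans (length-filter-∷ x xs) (cong (indicator (P? x) +_) (count-as-sum xs))

sumOver-comm : ∀ {a b} {A : Set a} {B : Set b} (f : A → B → ℕ) xs ys →
               sumOver (λ x → sumOver (f x) ys) xs ≡ sumOver (λ y → sumOver (λ x → f x y) xs) ys
sumOver-comm f [] ys = sym (trans (sumOver-const 0 ys) (*-zeroʳ (length ys)))
sumOver-comm f (x ∷ xs) ys = begin
  sumOver (f x) ys + sumOver (λ x → sumOver (f x) ys) xs            ≡⟨ cong (sumOver (f x) ys +_) (sumOver-comm f xs ys) ⟩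
  sumOver (f x) ys + sumOver (λ y → sumOver (λ x → f x y) xs) ys    ≡⟨ sumOver-+ (f x) (λ y → sumOver (λ x → f x y) xs) ys ⟨
  sumOver (λ y → f x y + sumOver (λ x → f x y) xs) ys                ∎
  where open ≡-Reasoning

count-pairs-comm : ∀ {a b r} {A : Set a} {B : Set b} {R : B → A → Set r} (R? : ∀ y → Decidable (R y))
                   (xs : List A) (ys : List B) →
                   sumOver (λ x → length (filter (λ y → R? y x) ys)) xs ≡ sumOver (λ y → length (filter (R? y) xs)) ys
count-pairs-comm R? xs ys = begin
  sumOver (λ x → length (filter (λ y → R? y x) ys)) xs          ≡⟨ sumOver-cong xs (λ x → count-as-sum (λ y → R? y x) ys) ⟩
  sumOver (λ x → sumOver (λ y → indicator (R? y x)) ys) xs      ≡⟨ sumOver-comm (λ x y → indicator (R? y x)) xs ys ⟩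
  sumOver (λ y → sumOver (λ x → indicator (R? y x)) xs) ys      ≡⟨ sumOver-cong ys (λ y → count-as-sum (R? y) xs) ⟨
  sumOver (λ y → length (filter (R? y) xs)) ys                  ∎
  where open ≡-Reasoning

cover-by-two : ∀ {a p q} {A : Set a} {P : A → Set p} {Q : A → Set q} (P? : Decidable P) (Q? : Decidable Q)
               (xs : List A) → (∀ x → x ∈ₗ xs → P x ⊎ Q x) →
               length xs ≤ length (filter P? xs) + length (filter Q? xs)
cover-by-two P? Q? [] covered = z≤n
cover-by-two P? Q? (x ∷ xs) covered with P? x | Q? x | covered x (here refl)
                                       | cover-by-two P? Q? xs (λ y y∈ → covered y (there y∈))
... | yes _ | yes _ | _      | ih = s≤s (≤-trans ih (+-monoʳ-≤ _ (n≤1+n _)))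
... | yes _ | no _  | _      | ih = s≤s ih
... | no _  | yes _ | _      | ih = ≤-trans (s≤s ih) (≤-reflexive (sym (+-suc _ _)))
... | no ¬p | no _  | inj₁ p | _  = ⊥-elim (¬p p)
... | no _  | no ¬q | inj₂ q | _  = ⊥-elim (¬q q)

double-count : ∀ {a b r₁ r₂} {A : Set a} {B : Set b} {R₁ : A → B → Set r₁} {R₂ : B → A → Set r₂}
               (R₁? : ∀ u → Decidable (R₁ u)) (R₂? : ∀ w → Decidable (R₂ w)) (U : List A) (W : List B) {D₁ D₂ : ℕ} →
               (∀ u w → u ∈ₗ U → w ∈ₗ W → R₁ u w ⊎ R₂ w u) →
               (∀ u → u ∈ₗ U → length (filter (R₁? u) W) ≤ D₁) →
               (∀ w → w ∈ₗ W → length (filter (R₂? w) U) ≤ D₂) →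
               length U * length W ≤ length U * D₁ + length W * D₂
double-count R₁? R₂? U W {D₁} {D₂} related bound₁ bound₂ = begin
  length U * length W                                 ≡⟨ sumOver-const (length W) U ⟨
  sumOver (λ _ → length W) U                          ≤⟨ sumOver-mono U covered ⟩
  sumOver (λ u → forward u + backward u) U            ≡⟨ sumOver-+ forward backward U ⟩
  sumOver forward U + sumOver backward U              ≡⟨ cong (sumOver forward U +_) (count-pairs-comm R₂? U W) ⟩
  sumOver forward U + sumOver (λ w → length (filter (R₂? w) U)) W
                                                      ≤⟨ +-mono-≤ (sumOver-bounded U bound₁) (sumOver-bounded W bound₂) ⟩
  length U * D₁ + length W * D₂                       ∎
  where
  open ≤-Reasoning
  forward backward : _ → ℕ
  forward u  = length (filter (R₁? u) W)
  backward u = length (filter (λ w → R₂? w u) W)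
  covered : ∀ u → u ∈ₗ U → length W ≤ forward u + backward u
  covered u u∈U = cover-by-two (R₁? u) (λ w → R₂? w u) W (λ w w∈W → related u w u∈U w∈W)

union-bound : ∀ {a k p} {A : Set a} {K : Set k} {P : K → A → Set p} (P? : ∀ k → Decidable (P k))
              (Ks : List K) (L : List A) → (∀ x → x ∈ₗ L → Any (λ k → P k x) Ks) →
              length L ≤ sumOver (λ k → length (filter (P? k) L)) Ks
union-bound P? Ks []      covered = z≤n
union-bound P? Ks (x ∷ L) covered = begin
  1 + length L                                                                  ≤⟨ +-mono-≤ hit rest ⟩
  sumOver (λ k → indicator (P? k x)) Ks + sumOver (λ k → length (filter (P? k) L)) Ks
                                                                                ≡⟨ sumOver-+ _ _ Ks ⟨
  sumOver (λ k → indicator (P? k x) + length (filter (P? k) L)) Ks              ≡⟨ sumOver-cong Ks (λ k → length-filter-∷ (P? k) x L) ⟨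
  sumOver (λ k → length (filter (P? k) (x ∷ L))) Ks                             ∎
  where
  open ≤-Reasoning
  hit : 1 ≤ sumOver (λ k → indicator (P? k x)) Ks
  hit = subst (1 ≤_) (count-as-sum (λ k → P? k x) Ks) (filter-some (λ k → P? k x) (covered x (here refl)))
  rest = union-bound P? Ks L (λ y y∈ → covered y (there y∈))

bound-if-inhabited : ∀ {a q} {A : Set a} {Q : Set q} {c} (xs : List A) →
                     (∀ x → x ∈ₗ xs → Q) → (Q → length xs ≤ c) → length xs ≤ c
bound-if-inhabited []       _       _     = z≤n
bound-if-inhabited (x ∷ xs) witness bound = bound (witness x (here refl))

unique-map : ∀ {a b} {A : Set a} {B : Set b} (f : A → B) (L : List A) → Unique L →
             (∀ x y → x ∈ₗ L → y ∈ₗ L → f x ≡ f y → x ≡ y) → Unique (map f L)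
unique-map f [] _ _ = []
unique-map f (x ∷ L) (x∉L ∷ uL) injective =
  images L x∉L (λ y y∈ → y∈) ∷ unique-map f L uL (λ y z y∈ z∈ → injective y z (there y∈) (there z∈))
  where
  images : ∀ ys → All (x ≢_) ys → (∀ y → y ∈ₗ ys → y ∈ₗ L) → All (f x ≢_) (map f ys)
  images []       _          _  = []
  images (y ∷ ys) (x≢y ∷ ne) ⊆L =
    (λ fx≡fy → x≢y (injective x y (here refl) (there (⊆L y (here refl))) fx≡fy)) ∷ images ys ne (λ z z∈ → ⊆L z (there z∈))

length-cartesianProduct : ∀ {a b} {A : Set a} {B : Set b} (xs : List A) (ys : List B) →
                          length (cartesianProduct xs ys) ≡ length xs * length ys
length-cartesianProduct []       ys = refl
length-cartesianProduct (x ∷ xs) ys =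
  trans (length-++ (map (x ,_) ys)) (cong₂ _+_ (length-map (x ,_) ys) (length-cartesianProduct xs ys))

two-positions⇒2≤count : ∀ {a p} {A : Set a} {P : A → Set p} (P? : Decidable P) (L : List A) (i j : Fin (length L)) →
                        i ≢ j → P (lookup L i) → P (lookup L j) → 2 ≤ length (filter P? L)
two-positions⇒2≤count P? (y ∷ L) zero    zero    i≢j _  _ = ⊥-elim (i≢j refl)
two-positions⇒2≤count P? (y ∷ L) zero    (suc j) _   py pj with P? y
... | yes _ = s≤s (filter-some P? {xs = L} (lose (∈-lookup {xs = L} j) pj))
... | no ¬p = ⊥-elim (¬p py)
two-positions⇒2≤count P? (y ∷ L) (suc i) zero    _   pi py with P? y
... | yes _ = s≤s (filter-some P? {xs = L} (lose (∈-lookup {xs = L} i) pi))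
... | no ¬p = ⊥-elim (¬p py)
two-positions⇒2≤count P? (y ∷ L) (suc i) (suc j) i≢j pi pj with P? y
... | yes _ = m≤n⇒m≤1+n (two-positions⇒2≤count P? L i j (i≢j ∘ cong suc) pi pj)
... | no _  = two-positions⇒2≤count P? L i j (i≢j ∘ cong suc) pi pj

distinct-members≤size : ∀ {n} (p : Subset n) (xs : List (Fin n)) → Unique xs → All (_∈ p) xs → length xs ≤ ∣ p ∣
distinct-members≤size p []       _          _           = z≤n
distinct-members≤size p (x ∷ xs) (x∉ ∷ uxs) (x∈p ∷ xs∈p) =
  ≤-trans (s≤s (distinct-members≤size (p - x) xs uxs (remain xs x∉ xs∈p))) (x∈p⇒∣p-x∣<∣p∣ x∈p)
  where
  remain : ∀ ys → All (x ≢_) ys → All (_∈ p) ys → All (_∈ p - x) ys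
  remain []       _          _           = []
  remain (y ∷ ys) (x≢y ∷ ne) (y∈p ∷ ys∈p) = x∈p∧x≢y⇒x∈p-y y∈p (≢-sym x≢y) ∷ remain ys ne ys∈p

∈⇒1≤size : ∀ {n} {p : Subset n} {z} → z ∈ p → 1 ≤ ∣ p ∣
∈⇒1≤size {p = p} {z} z∈p = distinct-members≤size p (z ∷ []) ([] ∷ []) (z∈p ∷ [])

common⇒1≤∣p∩q∣ : ∀ {n} {p q : Subset n} {z} → z ∈ p → z ∈ q → 1 ≤ ∣ p ∩ q ∣
common⇒1≤∣p∩q∣ z∈p z∈q = ∈⇒1≤size (x∈p∩q⁺ (z∈p , z∈q))

1≤size⇒nonempty : ∀ {n} (p : Subset n) → 1 ≤ ∣ p ∣ → Nonempty p
1≤size⇒nonempty {n} p 1≤∣p∣ with nonempty? p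
... | yes nonempty = nonempty
... | no empty     = ⊥-elim (n≮0 (subst (1 ≤_) (∣⊥∣≡0 n) (subst (λ q → 1 ≤ ∣ q ∣) (Empty-unique empty) 1≤∣p∣)))

size0⇒empty : ∀ {n} (p : Subset n) → ∣ p ∣ ≡ 0 → p ≡ ∅
size0⇒empty p ∣p∣≡0 = Empty-unique (λ (z , z∈p) → n≮0 (subst (1 ≤_) ∣p∣≡0 (∈⇒1≤size z∈p)))

suc∣p-x∣≡∣p∣ : ∀ {n} (p : Subset n) (x : Fin n) → x ∈ p → suc ∣ p - x ∣ ≡ ∣ p ∣
suc∣p-x∣≡∣p∣ (true ∷ p)  zero    here        = cong (suc ∘ ∣_∣) (p─⊥≡p p)
suc∣p-x∣≡∣p∣ (true ∷ p)  (suc x) (there x∈p) = cong suc (suc∣p-x∣≡∣p∣ p x x∈p)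
suc∣p-x∣≡∣p∣ (false ∷ p) (suc x) (there x∈p) = suc∣p-x∣≡∣p∣ p x x∈p

x∉p-x : ∀ {n} (p : Subset n) x → x ∉ p - x
x∉p-x (b ∷ p) zero    ()
x∉p-x (b ∷ p) (suc x) (there x∈) = x∉p-x p x x∈

another-member : ∀ {n} (p : Subset n) (y : Fin n) → 2 ≤ ∣ p ∣ → ∃ λ z → z ∈ p × z ≢ y
another-member p y 2≤∣p∣ with nonempty? (p - y)
... | yes (z , z∈p-y) = z , p─q⊆p p ⁅ y ⁆ z∈p-y , λ { refl → x∉p-x p y z∈p-y }
... | no empty        = ⊥-elim (<⇒≱ 2≤∣p∣ (≤-trans (p⊆q⇒∣p∣≤∣q∣ p⊆⁅y⁆) (≤-reflexive (∣⁅x⁆∣≡1 y))))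
  where
  p⊆⁅y⁆ : p ⊆ ⁅ y ⁆
  p⊆⁅y⁆ {z} z∈p with z Fin.≟ y
  ... | yes refl = x∈⁅x⁆ y
  ... | no z≢y   = ⊥-elim (empty (z , x∈p∧x≢y⇒x∈p-y z∈p z≢y))

exactly-one : ∀ {n} (s : Subset n) {x y} → x ≢ y → ∣ s ∩ (⁅ x ⁆ ∪ ⁅ y ⁆) ∣ ≡ 1 → (x ∈ s × y ∉ s) ⊎ (x ∉ s × y ∈ s)
exactly-one s {x} {y} x≢y one with x ∈? s | y ∈? s
... | yes x∈s | yes y∈s = ⊥-elim (n≮n 1 (subst (2 ≤_) one (distinct-members≤size _ (x ∷ y ∷ []) ((x≢y ∷ []) ∷ [] ∷ [])
                                      (x∈p∩q⁺ (x∈s , x∈p∪q⁺ (inj₁ (x∈⁅x⁆ x))) ∷ x∈p∩q⁺ (y∈s , x∈p∪q⁺ (inj₂ (x∈⁅x⁆ y))) ∷ []))))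
... | yes x∈s | no y∉s  = inj₁ (x∈s , y∉s)
... | no x∉s  | yes y∈s = inj₂ (x∉s , y∈s)
... | no x∉s  | no y∉s  with 1≤size⇒nonempty _ (≤-reflexive (sym one))
... | z , z∈  with x∈p∩q⁻ s _ z∈
... | z∈s , z∈xy with x∈p∪q⁻ ⁅ x ⁆ ⁅ y ⁆ z∈xy
... | inj₁ z∈⁅x⁆ = ⊥-elim (x∉s (subst (_∈ s) (x∈⁅y⁆⇒x≡y x z∈⁅x⁆) z∈s))
... | inj₂ z∈⁅y⁆ = ⊥-elim (y∉s (subst (_∈ s) (x∈⁅y⁆⇒x≡y y z∈⁅y⁆) z∈s))

elements : ∀ {n} → Subset n → List (Fin n)
elements {n} p = filter (_∈? p) (allFin n)

elements-unique : ∀ {n} (p : Subset n) → Unique (elements p)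
elements-unique {n} p = Unique.filter⁺ (_∈? p) (Unique.allFin⁺ n)

length-elements : ∀ {n} (p : Subset n) → length (elements p) ≤ ∣ p ∣
length-elements p = distinct-members≤size p (elements p) (elements-unique p)
                      (All.tabulate (λ z∈ → proj₂ (∈-filter⁻ (_∈? p) {xs = allFin _} z∈)))

∈-elements : ∀ {n} {p : Subset n} {z} → z ∈ p → z ∈ₗ elements p
∈-elements {p = p} {z} z∈p = ∈-filter⁺ (_∈? p) (∈-allFin z) z∈p

∉∧∈⇒≢ : ∀ {n} {p : Subset n} {c d} → c ∉ p → d ∈ p → c ≢ d
∉∧∈⇒≢ c∉p d∈p refl = c∉p d∈p

lookup⊆unionAll : ∀ {n} (B : List (Subset n)) (m : Fin (length B)) → lookup B m ⊆ unionAll B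
lookup⊆unionAll (v ∷ B) zero    = p⊆p∪q _
lookup⊆unionAll (v ∷ B) (suc m) = q⊆p∪q v (unionAll B) ∘ lookup⊆unionAll B m

unionAll⇒lookup : ∀ {n} (B : List (Subset n)) {y} → y ∈ unionAll B → ∃ λ m → y ∈ lookup B m
unionAll⇒lookup []      y∈ = ⊥-elim (∉⊥ y∈)
unionAll⇒lookup (v ∷ B) y∈ with x∈p∪q⁻ v _ y∈
... | inj₁ y∈v = zero , y∈v
... | inj₂ y∈B with unionAll⇒lookup B y∈B
... | m , y∈m = suc m , y∈m

withZero withoutZero : ∀ {n} → List (Subset (suc n)) → List (Subset n)
withZero []               = []
withZero ((true ∷ p) ∷ L)  = p ∷ withZero L
withZero ((false ∷ p) ∷ L) = withZero L
withoutZero []               = []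
withoutZero ((true ∷ p) ∷ L)  = withoutZero L
withoutZero ((false ∷ p) ∷ L) = p ∷ withoutZero L

length-split : ∀ {n} (L : List (Subset (suc n))) → length L ≡ length (withZero L) + length (withoutZero L)
length-split []               = refl
length-split ((true ∷ p) ∷ L)  = cong suc (length-split L)
length-split ((false ∷ p) ∷ L) = trans (cong suc (length-split L)) (sym (+-suc _ _))

withZero-unique : ∀ {n} (L : List (Subset (suc n))) → Unique L → Unique (withZero L)
withZero-unique []                _           = []
withZero-unique ((true ∷ p) ∷ L)  (p∉L ∷ uL) = others L p∉L ∷ withZero-unique L uL
  where
  others : ∀ L → All ((true ∷ p) ≢_) L → All (p ≢_) (withZero L)
  others []                _          = []
  others ((true ∷ q) ∷ L)  (ne ∷ nes) = ne ∘ cong (true ∷_) ∷ others L nes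
  others ((false ∷ q) ∷ L) (_  ∷ nes) = others L nes
withZero-unique ((false ∷ p) ∷ L) (_ ∷ uL)   = withZero-unique L uL

withoutZero-unique : ∀ {n} (L : List (Subset (suc n))) → Unique L → Unique (withoutZero L)
withoutZero-unique []                _           = []
withoutZero-unique ((true ∷ p) ∷ L)  (_ ∷ uL)    = withoutZero-unique L uL
withoutZero-unique ((false ∷ p) ∷ L) (p∉L ∷ uL) = others L p∉L ∷ withoutZero-unique L uL
  where
  others : ∀ L → All ((false ∷ p) ≢_) L → All (p ≢_) (withoutZero L)
  others []                _          = []
  others ((true ∷ q) ∷ L)  (_  ∷ nes) = others L nes
  others ((false ∷ q) ∷ L) (ne ∷ nes) = ne ∘ cong (false ∷_) ∷ others L nes

withZero-size : ∀ {n} k (L : List (Subset (suc n))) → All (λ w → ∣ w ∣ ≡ suc k) L → All (λ w → ∣ w ∣ ≡ k) (withZero L)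
withZero-size k []                _          = []
withZero-size k ((true ∷ p) ∷ L)  (sz ∷ szs) = suc-injective sz ∷ withZero-size k L szs
withZero-size k ((false ∷ p) ∷ L) (_  ∷ szs) = withZero-size k L szs

withoutZero-size : ∀ {n} k (L : List (Subset (suc n))) → All (λ w → ∣ w ∣ ≡ k) L → All (λ w → ∣ w ∣ ≡ k) (withoutZero L)
withoutZero-size k []                _          = []
withoutZero-size k ((true ∷ p) ∷ L)  (_  ∷ szs) = withoutZero-size k L szs
withoutZero-size k ((false ∷ p) ∷ L) (sz ∷ szs) = sz ∷ withoutZero-size k L szs

-- There are at most C(n, k) distinct k-subsets of Fin n (Pascal's rule).
k-subsets≤binomial : ∀ n k (L : List (Subset n)) → Unique L → All (λ w → ∣ w ∣ ≡ k) L → length L ≤ n C k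
k-subsets≤binomial n       zero    []           _                _                       = z≤n
k-subsets≤binomial n       zero    (w ∷ [])     _                _                       = ≤-refl
k-subsets≤binomial n       zero    (w ∷ w′ ∷ L) ((w≢w′ ∷ _) ∷ _) (∣w∣≡0 ∷ ∣w′∣≡0 ∷ _) =
  ⊥-elim (w≢w′ (trans (size0⇒empty w ∣w∣≡0) (sym (size0⇒empty w′ ∣w′∣≡0))))
k-subsets≤binomial zero    (suc k) []           _                _                       = z≤n
k-subsets≤binomial zero    (suc k) ([] ∷ L)     _                (() ∷ _)
k-subsets≤binomial (suc n) (suc k) L            uL               sizes                   = begin
  length L                                       ≡⟨ length-split L ⟩
  length (withZero L) + length (withoutZero L)   ≤⟨ +-mono-≤ (k-subsets≤binomial n k _ (withZero-unique L uL) (withZero-size k L sizes))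
                                                              (k-subsets≤binomial n (suc k) _ (withoutZero-unique L uL) (withoutZero-size (suc k) L sizes)) ⟩
  n C k + n C suc k                              ≡⟨ nCk+nC[k+1]≡[n+1]C[k+1] n k ⟩
  suc n C suc k                                  ∎
  where open ≤-Reasoning

remove-injective : ∀ {n} {a b : Subset n} {e} → e ∈ a → e ∈ b → a - e ≡ b - e → a ≡ b
remove-injective e∈a e∈b a-e≡b-e = ⊆-antisym (included e∈b a-e≡b-e) (included e∈a (sym a-e≡b-e))
  where
  included : ∀ {a b e} → e ∈ b → a - e ≡ b - e → a ⊆ b
  included {e = e} e∈b eq {z} z∈a with z Fin.≟ e
  ... | yes refl = e∈b
  ... | no z≢e   = p─q⊆p _ ⁅ e ⁆ (subst (z ∈_) eq (x∈p∧x≢y⇒x∈p-y z∈a z≢e))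

-- At most C(n, m) distinct sets of size |Es| + m contain all of the distinct
-- points Es: removing Es maps them injectively to m-sets.
subsets-through≤binomial : ∀ {n} m (Es : List (Fin n)) (L : List (Subset n)) → Unique Es → Unique L →
                           (∀ w → w ∈ₗ L → ∣ w ∣ ≡ length Es + m × All (_∈ w) Es) → length L ≤ n C m
subsets-through≤binomial {n} m [] L _ uL through = k-subsets≤binomial n m L uL (All.tabulate (λ {w} w∈ → proj₁ (through w w∈)))
subsets-through≤binomial {n} m (e ∷ Es) L (e∉Es ∷ uEs) uL through =
  ≤-trans (≤-reflexive (sym (length-map (_- e) L)))
          (subsets-through≤binomial m Es (map (_- e) L) uEs (unique-map (_- e) L uL injective) removed)
  where
  injective : ∀ a b → a ∈ₗ L → b ∈ₗ L → a - e ≡ b - e → a ≡ b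
  injective a b a∈ b∈ = remove-injective (All.head (proj₂ (through a a∈))) (All.head (proj₂ (through b b∈)))
  removed : ∀ w′ → w′ ∈ₗ map (_- e) L → ∣ w′ ∣ ≡ length Es + m × All (_∈ w′) Es
  removed w′ w′∈ with ∈-map⁻ (_- e) w′∈
  ... | w , w∈ , refl with through w w∈
  ... | size , (e∈w ∷ Es⊆w) =
    suc-injective (trans (suc∣p-x∣≡∣p∣ w e e∈w) size) ,
    All.zipWith (λ (e≢z , z∈w) → x∈p∧x≢y⇒x∈p-y z∈w (≢-sym e≢z)) (e∉Es , Es⊆w)

-- An upper bound for the number of distinct r-subsets of Fin n through five
-- fixed distinct points: C(n, r-5), and 0 when r < 5.
throughFive : ℕ → ℕ → ℕ
throughFive (suc (suc (suc (suc (suc m))))) n = n C m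
throughFive _                               n = 0

no-small-sets : ∀ {n r} (Es : List (Fin n)) → length Es ≡ 5 → Unique Es → r < 5 → (L : List (Subset n)) →
                (∀ w → w ∈ₗ L → ∣ w ∣ ≡ r × All (_∈ w) Es) → length L ≤ 0
no-small-sets Es five uEs r<5 L through = bound-if-inhabited L impossible ⊥-elim
  where
  impossible : ∀ w → w ∈ₗ L → _
  impossible w w∈ = <⇒≱ r<5 (subst₂ _≤_ five (proj₁ (through w w∈)) (distinct-members≤size w Es uEs (proj₂ (through w w∈))))

r-sets-through-five≤ : ∀ r {n} (Es : List (Fin n)) → length Es ≡ 5 → Unique Es → (L : List (Subset n)) → Unique L →
                       (∀ w → w ∈ₗ L → ∣ w ∣ ≡ r × All (_∈ w) Es) → length L ≤ throughFive r n
r-sets-through-five≤ (suc (suc (suc (suc (suc m))))) Es five uEs L uL through =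
  subsets-through≤binomial m Es L uEs uL (λ w w∈ → trans (proj₁ (through w w∈)) (cong (_+ m) (sym five)) , proj₂ (through w w∈))
r-sets-through-five≤ 0 Es five uEs L _ = no-small-sets Es five uEs (s≤s z≤n) L
r-sets-through-five≤ 1 Es five uEs L _ = no-small-sets Es five uEs (s≤s (s≤s z≤n)) L
r-sets-through-five≤ 2 Es five uEs L _ = no-small-sets Es five uEs (s≤s (s≤s (s≤s z≤n))) L
r-sets-through-five≤ 3 Es five uEs L _ = no-small-sets Es five uEs (s≤s (s≤s (s≤s (s≤s z≤n)))) L
r-sets-through-five≤ 4 Es five uEs L _ = no-small-sets Es five uEs (s≤s (s≤s (s≤s (s≤s (s≤s z≤n))))) L

binomial-pos : ∀ n m → m ≤ n → 1 ≤ n C m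
binomial-pos n       zero    _         = ≤-refl
binomial-pos (suc n) (suc m) (s≤s m≤n) = begin
  1                   ≤⟨ binomial-pos n m m≤n ⟩
  n C m               ≤⟨ m≤m+n _ _ ⟩
  n C m + n C suc m   ≡⟨ nCk+nC[k+1]≡[n+1]C[k+1] n m ⟩
  suc n C suc m       ∎
  where open ≤-Reasoning

-- The number of sets a member of A₁ can be linked to (see Core): r⁴·throughFive r n.
linkBound : ℕ → ℕ → ℕ
linkBound r n = r * (r * (r * r) * throughFive r n)

twice-linkBound<ω : ∀ r n → 4 ≤ r → r ≤ n → 2 * linkBound r n < ω r n
twice-linkBound<ω 0 n ()
twice-linkBound<ω 1 n (s≤s ())
twice-linkBound<ω 2 n (s≤s (s≤s ()))
twice-linkBound<ω 3 n (s≤s (s≤s (s≤s ())))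
twice-linkBound<ω 4 n _ _ = s≤s z≤n
twice-linkBound<ω r@(suc (suc (suc (suc (suc m))))) n _ r≤n = begin-strict
  2 * linkBound r n   ≡⟨ factor r (n C m) ⟩
  2 * X               <⟨ *-monoˡ-< X {{>-nonZero 0<X}} 2<r ⟩
  r * X               ≡⟨ unfactor r (n C m) ⟩
  ω r n               ∎
  where
  open ≤-Reasoning
  X = r * (r * (r * r)) * (n C m)
  2<r : 2 < r
  2<r = s≤s (s≤s (s≤s z≤n))
  0<X : 0 < X
  0<X = *-mono-≤ {1} {r * (r * (r * r))} (s≤s z≤n) (binomial-pos n m (≤-trans (m≤n+m m 5) r≤n))
  factor : ∀ R c → 2 * (R * (R * (R * R) * c)) ≡ 2 * (R * (R * (R * R)) * c)
  factor = solve-∀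
  unfactor : ∀ R c → R * (R * (R * (R * R)) * c) ≡ R * (R * (R * (R * (R * 1)))) * c
  unfactor = solve-∀

product-too-large : ∀ {a b D M} → M ≤ a → M ≤ b → 2 * D < M → ¬ (a * b ≤ a * D + b * D)
product-too-large {a} {b} {D} M≤a M≤b 2D<M ab≤ = <-irrefl refl (begin-strict
  2 * (a * b)                 ≤⟨ *-monoʳ-≤ 2 ab≤ ⟩
  2 * (a * D + b * D)         ≡⟨ distribute a b D ⟩
  a * (2 * D) + b * (2 * D)   <⟨ +-mono-< (*-monoʳ-< a {{>-nonZero 0<a}} 2D<b) (*-monoʳ-< b {{>-nonZero 0<b}} 2D<a) ⟩
  a * b + b * a               ≡⟨ double a b ⟩
  2 * (a * b)                 ∎)
  where
  open ≤-Reasoning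
  2D<a = <-≤-trans 2D<M M≤a
  2D<b = <-≤-trans 2D<M M≤b
  0<a = ≤-<-trans z≤n 2D<a
  0<b = ≤-<-trans z≤n 2D<b
  distribute : ∀ a b D → 2 * (a * D + b * D) ≡ a * (2 * D) + b * (2 * D)
  distribute = solve-∀
  double : ∀ a b → a * b + b * a ≡ 2 * (a * b)
  double = solve-∀

module Core {n r : ℕ} (A A₀ : List (Subset n)) (indep : Independent r A)
            (A₀⊆A : ∀ v → v ∈ₗ A₀ → v ∈ₗ A) (x : Fin n) (x∉I₀ : x ∉ unionAll A₀) where

  open import Data.List.Membership.DecPropositional (_≟ₛ_ {n}) using (_∉?_)

  A1 : List (Subset n)
  A1 = A₁ A A₀

  V : Fin (length A₀) → Subset n
  V = lookup A₀

  ∈-A1 : ∀ {v} → v ∈ₗ A1 → v ∈ₗ A × v ∉ₗ A₀ × meetCount A₀ v ≡ 1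
  ∈-A1 = ∈-filter⁻ (λ v → (v ∉? A₀) ×-dec (meetCount A₀ v N.≟ 1)) {xs = A}

  A1⊆A : ∀ {v} → v ∈ₗ A1 → v ∈ₗ A
  A1⊆A = proj₁ ∘ ∈-A1

  Through : Fin (length A₀) → List (Subset n)
  Through i = filter (λ v → (x ∈? v) ×-dec (1 N.≤? ∣ v ∩ V i ∣)) A1

  ∈-Through : ∀ {i v} → v ∈ₗ Through i → v ∈ₗ A1 × x ∈ v × 1 ≤ ∣ v ∩ V i ∣
  ∈-Through {i} = ∈-filter⁻ (λ v → (x ∈? v) ×-dec (1 N.≤? ∣ v ∩ V i ∣)) {xs = A1}

  Through-unique : ∀ i → Unique (Through i)
  Through-unique i = Unique.filter⁺ _ (Unique.filter⁺ _ (proj₁ indep))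

  block-in-A : ∀ j → V j ∈ₗ A
  block-in-A j = A₀⊆A _ (∈-lookup j)

  length-elements≤r : ∀ {p} → p ∈ₗ A → length (elements p) ≤ r
  length-elements≤r {p} p∈ = ≤-trans (length-elements p) (≤-reflexive (proj₁ (proj₂ indep) p p∈))

  second-common : ∀ {u v} → u ∈ₗ A → v ∈ₗ A → u ≢ v → 1 ≤ ∣ u ∩ v ∣ → 2 ≤ ∣ u ∩ v ∣
  second-common u∈ v∈ u≢v 1≤ = ≤∧≢⇒< 1≤ (λ one → proj₂ (proj₂ indep) _ _ u∈ v∈ u≢v (sym one))

  one-block : ∀ {v} → v ∈ₗ A1 → ∀ {a b} → 1 ≤ ∣ v ∩ V a ∣ → 1 ≤ ∣ v ∩ V b ∣ → a ≡ b
  one-block {v} v∈ {a} {b} meets-a meets-b with a Fin.≟ b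
  ... | yes a≡b = a≡b
  ... | no a≢b  = ⊥-elim (<-irrefl (sym (proj₂ (proj₂ (∈-A1 v∈))))
                                   (two-positions⇒2≤count (λ u → 1 N.≤? ∣ v ∩ u ∣) A₀ a b a≢b meets-a meets-b))

  SeparatesMissing : Fin (length A₀) → Fin n → Subset n → Set
  SeparatesMissing j y s = ∣ s ∩ (⁅ x ⁆ ∪ ⁅ y ⁆) ∣ ≡ 1 × ¬ (1 ≤ ∣ s ∩ V j ∣)

  Witness : Fin (length A₀) → Fin n → Set
  Witness j y = y ≢ x × y ∉ V j × Any (SeparatesMissing j y) A1

  Carries : Fin (length A₀) → Fin n → Subset n → Set
  Carries j y w = y ∈ w × Witness j y

  Carries? : ∀ j y → Decidable (Carries j y)
  Carries? j y w = (y ∈? w) ×-dec ¬? (y Fin.≟ x) ×-dec ¬? (y ∈? V j)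
                   ×-dec any? (λ s → (∣ s ∩ (⁅ x ⁆ ∪ ⁅ y ⁆) ∣ N.≟ 1) ×-dec ¬? (1 N.≤? ∣ s ∩ V j ∣)) A1

  Linked : Fin (length A₀) → Subset n → Subset n → Set
  Linked j z w = Any (λ y → Carries j y w) (elements z)

  Linked? : ∀ j z → Decidable (Linked j z)
  Linked? j z w = any? (λ y → Carries? j y w) (elements z)

  another-shared : ∀ {s w p q} → s ∈ₗ A → w ∈ₗ A → p ∈ s → p ∈ w → q ∉ s → q ∈ w →
                   ∃ λ t → t ∈ s × t ∈ w × t ≢ p × t ≢ q
  another-shared {s} {w} {p} s∈ w∈ p∈s p∈w q∉s q∈w
    with another-member (s ∩ w) p (second-common s∈ w∈ (λ { refl → q∉s q∈w }) (common⇒1≤∣p∩q∣ p∈s p∈w))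
  ... | t , t∈s∩w , t≢p with x∈p∩q⁻ s w t∈s∩w
  ... | t∈s , t∈w = t , t∈s , t∈w , t≢p , ≢-sym (∉∧∈⇒≢ q∉s t∈s)

  third-point : ∀ {s w y} → s ∈ₗ A1 → ∣ s ∩ (⁅ x ⁆ ∪ ⁅ y ⁆) ∣ ≡ 1 → y ≢ x → w ∈ₗ A1 → x ∈ w → y ∈ w →
                ∃ λ t → t ∈ s × t ∈ w × t ≢ x × t ≢ y
  third-point {s} s∈ one y≢x w∈ x∈w y∈w with exactly-one s (≢-sym y≢x) one
  ... | inj₁ (x∈s , y∉s) = another-shared (A1⊆A s∈) (A1⊆A w∈) x∈s x∈w y∉s y∈w
  ... | inj₂ (x∉s , y∈s) with another-shared (A1⊆A s∈) (A1⊆A w∈) y∈s y∈w x∉s x∈w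
  ...   | t , t∈s , t∈w , t≢y , t≢x = t , t∈s , t∈w , t≢x , t≢y

  not-a-block : ∀ {w} j → w ∈ₗ A1 → w ≢ V j
  not-a-block j w∈ w≡vⱼ = proj₁ (proj₂ (∈-A1 w∈)) (subst (_∈ₗ A₀) (sym w≡vⱼ) (∈-lookup j))

  two-in-block : ∀ {w} j → w ∈ₗ A1 → 1 ≤ ∣ w ∩ V j ∣ → ∃₂ λ a b → (a ∈ w × a ∈ V j) × (b ∈ w × b ∈ V j) × b ≢ a
  two-in-block {w} j w∈ meets with 1≤size⇒nonempty _ meets
  ... | a , a∈ with another-member (w ∩ V j) a (second-common (A1⊆A w∈) (block-in-A j) (not-a-block j w∈) meets)
  ... | b , b∈ , b≢a = a , b , x∈p∩q⁻ w (V j) a∈ , x∈p∩q⁻ w (V j) b∈ , b≢a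

  fivePoints : Fin n → Fin n × Fin n × Fin n → List (Fin n)
  fivePoints y (t , a , b) = x ∷ y ∷ t ∷ a ∷ b ∷ []

  ContainsFive : Fin n → Fin n × Fin n × Fin n → Subset n → Set
  ContainsFive y k w = Unique (fivePoints y k) × All (_∈ w) (fivePoints y k)

  ContainsFive? : ∀ y k → Decidable (ContainsFive y k)
  ContainsFive? y k w = allPairs? (λ c d → ¬? (c Fin.≟ d)) (fivePoints y k) ×-dec all? (_∈? w) (fivePoints y k)

  keys : Subset n → Fin (length A₀) → List (Fin n × Fin n × Fin n)
  keys s j = cartesianProduct (elements s) (cartesianProduct (elements (V j)) (elements (V j)))

  length-keys : ∀ {s} j → s ∈ₗ A1 → length (keys s j) ≤ r * (r * r)
  length-keys {s} j s∈ = begin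
    length (keys s j)
      ≡⟨ trans (length-cartesianProduct (elements s) _) (cong (length (elements s) *_) (length-cartesianProduct (elements (V j)) _)) ⟩
    length (elements s) * (length (elements (V j)) * length (elements (V j)))
      ≤⟨ *-mono-≤ (length-elements≤r (A1⊆A s∈)) (*-mono-≤ (length-elements≤r (block-in-A j)) (length-elements≤r (block-in-A j))) ⟩
    r * (r * r) ∎
    where open ≤-Reasoning

  five-distinct : ∀ {j y t a b} → y ≢ x → y ∉ V j → t ∉ V j → t ≢ x → t ≢ y → a ∈ V j → b ∈ V j → b ≢ a →
                  Unique (x ∷ y ∷ t ∷ a ∷ b ∷ [])
  five-distinct {j} y≢x y∉vⱼ t∉vⱼ t≢x t≢y a∈vⱼ b∈vⱼ b≢a =
      (≢-sym y≢x ∷ ≢-sym t≢x ∷ ∉∧∈⇒≢ x∉vⱼ a∈vⱼ ∷ ∉∧∈⇒≢ x∉vⱼ b∈vⱼ ∷ [])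
    ∷ (≢-sym t≢y ∷ ∉∧∈⇒≢ y∉vⱼ a∈vⱼ ∷ ∉∧∈⇒≢ y∉vⱼ b∈vⱼ ∷ [])
    ∷ (∉∧∈⇒≢ t∉vⱼ a∈vⱼ ∷ ∉∧∈⇒≢ t∉vⱼ b∈vⱼ ∷ [])
    ∷ (≢-sym b≢a ∷ [])
    ∷ [] ∷ []
    where
    x∉vⱼ : x ∉ V j
    x∉vⱼ = x∉I₀ ∘ lookup⊆unionAll A₀ j

  five-points : ∀ {j y s w} → y ≢ x → y ∉ V j → s ∈ₗ A1 → SeparatesMissing j y s →
                w ∈ₗ A1 → x ∈ w → y ∈ w → 1 ≤ ∣ w ∩ V j ∣ → Any (λ k → ContainsFive y k w) (keys s j)
  five-points {j} y≢x y∉vⱼ s∈ (one , s-misses) w∈ x∈w y∈w meets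
    with third-point s∈ one y≢x w∈ x∈w y∈w | two-in-block j w∈ meets
  ... | t , t∈s , t∈w , t≢x , t≢y | a , b , (a∈w , a∈vⱼ) , (b∈w , b∈vⱼ) , b≢a =
    lose (∈-cartesianProduct⁺ (∈-elements t∈s) (∈-cartesianProduct⁺ (∈-elements a∈vⱼ) (∈-elements b∈vⱼ)))
         (five-distinct y≢x y∉vⱼ (s-misses ∘ common⇒1≤∣p∩q∣ t∈s) t≢x t≢y a∈vⱼ b∈vⱼ b≢a ,
          x∈w ∷ y∈w ∷ t∈w ∷ a∈w ∷ b∈w ∷ [])

  through-witness≤ : ∀ {j y s} → y ≢ x → y ∉ V j → s ∈ₗ A1 → SeparatesMissing j y s →
                     (L : List (Subset n)) → Unique L →
                     (∀ w → w ∈ₗ L → (w ∈ₗ A1 × x ∈ w × 1 ≤ ∣ w ∩ V j ∣) × y ∈ w) →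
                     length L ≤ r * (r * r) * throughFive r n
  through-witness≤ {j} {y} {s} y≢x y∉vⱼ s∈ separates L uL members = begin
    length L                                                         ≤⟨ union-bound (ContainsFive? y) (keys s j) L covered ⟩
    sumOver (λ k → length (filter (ContainsFive? y k) L)) (keys s j) ≤⟨ sumOver-bounded (keys s j) (λ k _ → per-key k) ⟩
    length (keys s j) * throughFive r n                              ≤⟨ *-monoˡ-≤ (throughFive r n) (length-keys j s∈) ⟩
    r * (r * r) * throughFive r n                                    ∎
    where
    open ≤-Reasoning
    covered : ∀ w → w ∈ₗ L → Any (λ k → ContainsFive y k w) (keys s j)
    covered w w∈ = let ((w∈A1 , x∈w , meets) , y∈w) = members w w∈ in
                   five-points y≢x y∉vⱼ s∈ separates w∈A1 x∈w y∈w meets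
    per-key : ∀ k → length (filter (ContainsFive? y k) L) ≤ throughFive r n
    per-key k = bound-if-inhabited _ (λ w w∈ → proj₁ (proj₂ (∈-filter⁻ (ContainsFive? y k) {xs = L} w∈)))
                  (λ distinct → r-sets-through-five≤ r (fivePoints y k) refl distinct _ (Unique.filter⁺ _ uL) sized)
      where
      sized : ∀ w → w ∈ₗ filter (ContainsFive? y k) L → ∣ w ∣ ≡ r × All (_∈ w) (fivePoints y k)
      sized w w∈ = let (w∈L , _ , five∈w) = ∈-filter⁻ (ContainsFive? y k) {xs = L} w∈ in
                   proj₁ (proj₂ indep) w (A1⊆A (proj₁ (proj₁ (members w w∈L)))) , five∈w

  linked≤ : ∀ {j z} → z ∈ₗ A1 → (L : List (Subset n)) → Unique L →
            (∀ w → w ∈ₗ L → w ∈ₗ A1 × x ∈ w × 1 ≤ ∣ w ∩ V j ∣) → length (filter (Linked? j z) L) ≤ linkBound r n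
  linked≤ {j} {z} z∈ L uL members = begin
    length L′                                                         ≤⟨ union-bound (Carries? j) (elements z) L′ linked ⟩
    sumOver (λ y → length (filter (Carries? j y) L′)) (elements z)    ≤⟨ sumOver-bounded (elements z) (λ y _ → per-point y) ⟩
    length (elements z) * (r * (r * r) * throughFive r n)             ≤⟨ *-monoˡ-≤ _ (length-elements≤r (A1⊆A z∈)) ⟩
    linkBound r n                                                     ∎
    where
    open ≤-Reasoning
    L′ = filter (Linked? j z) L
    linked : ∀ w → w ∈ₗ L′ → Linked j z w
    linked w w∈ = proj₂ (∈-filter⁻ (Linked? j z) {xs = L} w∈)
    carrying : ∀ y w → w ∈ₗ filter (Carries? j y) L′ → (w ∈ₗ A1 × x ∈ w × 1 ≤ ∣ w ∩ V j ∣) × y ∈ w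
    carrying y w w∈ = let (w∈L′ , y∈w , _) = ∈-filter⁻ (Carries? j y) {xs = L′} w∈ in
                      members w (proj₁ (∈-filter⁻ (Linked? j z) {xs = L} w∈L′)) , y∈w
    per-point : ∀ y → length (filter (Carries? j y) L′) ≤ r * (r * r) * throughFive r n
    per-point y = bound-if-inhabited _ (λ w w∈ → proj₂ (proj₂ (∈-filter⁻ (Carries? j y) {xs = L′} w∈)))
      λ (y≢x , y∉vⱼ , separated) → let (s , s∈ , separates) = find separated in
        through-witness≤ y≢x y∉vⱼ s∈ separates _ (Unique.filter⁺ _ (Unique.filter⁺ _ uL)) (carrying y)

  common-outside-I₀ : ∀ {i j u w y} → i ≢ j → u ∈ₗ A1 → 1 ≤ ∣ u ∩ V i ∣ → w ∈ₗ A1 → 1 ≤ ∣ w ∩ V j ∣ →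
                      y ∈ u → y ∈ w → y ∉ unionAll A₀
  common-outside-I₀ i≢j u∈ u-meets w∈ w-meets y∈u y∈w y∈I₀ with unionAll⇒lookup A₀ y∈I₀
  ... | m , y∈vₘ = i≢j (trans (one-block u∈ u-meets (common⇒1≤∣p∩q∣ y∈u y∈vₘ))
                             (sym (one-block w∈ w-meets (common⇒1≤∣p∩q∣ y∈w y∈vₘ))))

  shared-point : ∀ {i j u w} → i ≢ j → u ∈ₗ A1 → x ∈ u → 1 ≤ ∣ u ∩ V i ∣ → w ∈ₗ A1 → x ∈ w → 1 ≤ ∣ w ∩ V j ∣ →
                 ∃ λ y → y ∈ u × y ∈ w × y ≢ x × y ∉ unionAll A₀
  shared-point {u = u} {w} i≢j u∈ x∈u u-meets w∈ x∈w w-meets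
    with another-member (u ∩ w) x (second-common (A1⊆A u∈) (A1⊆A w∈) (λ { refl → i≢j (one-block u∈ u-meets w-meets) })
                                                 (common⇒1≤∣p∩q∣ x∈u x∈w))
  ... | y , y∈u∩w , y≢x with x∈p∩q⁻ u w y∈u∩w
  ... | y∈u , y∈w = y , y∈u , y∈w , y≢x , common-outside-I₀ i≢j u∈ u-meets w∈ w-meets y∈u y∈w

  separator : ∀ {y} → ¬ InP A A₀ x → y ∉ unionAll A₀ → y ≢ x → Any (λ s → ∣ s ∩ (⁅ x ⁆ ∪ ⁅ y ⁆) ∣ ≡ 1) A1
  separator {y} x∉P y∉I₀ y≢x with any? (λ s → ∣ s ∩ (⁅ x ⁆ ∪ ⁅ y ⁆) ∣ N.≟ 1) A1
  ... | yes separated = separated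
  ... | no joint      = ⊥-elim (x∉P (x∉I₀ , y , y∉I₀ , ≢-sym y≢x , λ s s∈ one → joint (lose s∈ one)))

  linked-either-way : ∀ {i j u w} → i ≢ j → ¬ InP A A₀ x → u ∈ₗ Through i → w ∈ₗ Through j → Linked j u w ⊎ Linked i w u
  linked-either-way {i} {j} i≢j x∉P u∈ w∈ with ∈-Through u∈ | ∈-Through w∈
  ... | u∈A1 , x∈u , u-meets | w∈A1 , x∈w , w-meets with shared-point i≢j u∈A1 x∈u u-meets w∈A1 x∈w w-meets
  ... | y , y∈u , y∈w , y≢x , y∉I₀ with find (separator x∉P y∉I₀ y≢x)
  ... | s , s∈ , one with 1 N.≤? ∣ s ∩ V j ∣
  ... | no s-misses-j = inj₁ (lose (∈-elements y∈u) (y∈w , y≢x , y∉I₀ ∘ lookup⊆unionAll A₀ j , lose s∈ (one , s-misses-j)))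
  ... | yes s-meets-j = inj₂ (lose (∈-elements y∈w) (y∈u , y≢x , y∉I₀ ∘ lookup⊆unionAll A₀ i ,
                                   lose s∈ (one , λ s-meets-i → i≢j (one-block s∈ s-meets-i s-meets-j))))

  product-bound : ∀ {i j} → i ≢ j → ¬ InP A A₀ x →
                  length (Through i) * length (Through j) ≤ length (Through i) * linkBound r n + length (Through j) * linkBound r n
  product-bound {i} {j} i≢j x∉P =
    double-count (Linked? j) (Linked? i) (Through i) (Through j)
      (λ u w u∈ w∈ → linked-either-way i≢j x∉P u∈ w∈)
      (λ u u∈ → linked≤ (proj₁ (∈-Through u∈)) (Through j) (Through-unique j) (λ w → ∈-Through))
      (λ w w∈ → linked≤ (proj₁ (∈-Through w∈)) (Through i) (Through-unique i) (λ u → ∈-Through))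

lemma2 : ∀ r → 4 ≤ r → ∃ λ N → ∀ n → N ≤ n →
           (A : List (Subset n)) → Independent r A →
           (A₀ : List (Subset n)) → MaxDisjointSubfamily A A₀ →
           (x : Fin n) → x ∉ unionAll A₀ → ¬ InP A A₀ x →
           (i j : Fin (length A₀)) → i ≢ j →
           ¬ (Connected r A A₀ x i × Connected r A A₀ x j)
lemma2 r 4≤r = r , λ n r≤n A indep A₀ maxd x x∉I₀ x∉P i j i≢j (connected-i , connected-j) →
  let A₀⊆A = proj₁ (proj₂ (proj₁ maxd)) in
  product-too-large connected-i connected-j (twice-linkBound<ω r n 4≤r r≤n)
    (Core.product-bound A A₀ indep A₀⊆A x x∉I₀ i≢j x∉P)
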